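{- A (simple, connected) graph $G$ is an arborescence if and only if $G$ is a treelike comparability graph having no induced subgraph isomorphic to $C_4$ and no induced subgraph isomorphic to $P_4$.
   Context: A graph is a comparability graph if it admits a transitive orientation. A treelike comparability graph is one admitting a transitive orientation (its treelike orientation) whose Hasse diagram (transitive reduction), as an undirected graph, is a tree. A double-arborescence is a treelike comparability graph $G=(V,E)$ with a vertex $r$ (a root) such that $V=\{r\}\cup N_G(r)$; it is an arborescence if, under the treelike orientation, a root is a source (indegree zero) or a sink (outdegree zero). $C_4$ is the cycle and $P_4$ the path on four vertices. -}

module Defs where

open import Data.Nat using (ℕ; zero; suc; _<_; _+_)
open import Data.Fin using (Fin; zero; suc; inject₁; fromℕ)
open import Data.Bool using (Bool; true; false)
open import Data.Product using (Σ; _×_; ∃)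
open import Data.Sum using (_⊎_)
open import Relation.Nullary using (¬_)
open import Relation.Binary.PropositionalEquality using (_≡_; refl)
open import Relation.Binary.Construct.Closure.ReflexiveTransitive using (Star)
open import Function.Definitions using (Injective)

record Graph (n : ℕ) : Set where
  field
    adj    : Fin n → Fin n → Bool
    adj-sym    : ∀ u v → adj u v ≡ adj v u
    adj-irrefl : ∀ v → adj v v ≡ false
open Graph public

Edge : ∀ {n} → Graph n → Fin n → Fin n → Set
Edge G u v = adj G u v ≡ true

ConnectedRel : ∀ {n} → (Fin n → Fin n → Set) → Set
ConnectedRel {n} R = (0 < n) × (∀ u v → Star R u v)

Connected : ∀ {n} → Graph n → Set
Connected G = ConnectedRel (Edge G)

HasCycle : ∀ {n} → (Fin n → Fin n → Set) → Set
HasCycle {n} R =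
  Σ ℕ λ k → Σ (Fin (suc (suc (suc k))) → Fin n) λ f →
    Injective _≡_ _≡_ f ×
    (∀ (i : Fin (suc (suc k))) → R (f (inject₁ i)) (f (suc i))) ×
    R (f (fromℕ (suc (suc k)))) (f zero)

IsTree : ∀ {n} → (Fin n → Fin n → Set) → Set
IsTree R = ConnectedRel R × ¬ HasCycle R

IsOrientation : ∀ {n} → Graph n → (Fin n → Fin n → Bool) → Set
IsOrientation G D =
  (∀ u v → adj G u v ≡ true → D u v ≡ true ⊎ D v u ≡ true) ×
  (∀ u v → D u v ≡ true → adj G u v ≡ true) ×
  (∀ u v → D u v ≡ true → D v u ≡ false)

IsTransitive : ∀ {n} → (Fin n → Fin n → Bool) → Set
IsTransitive D = ∀ u v w → D u v ≡ true → D v w ≡ true → D u w ≡ true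

IsTransitiveOrientation : ∀ {n} → Graph n → (Fin n → Fin n → Bool) → Set
IsTransitiveOrientation G D = IsOrientation G D × IsTransitive D

Cover : ∀ {n} → (Fin n → Fin n → Bool) → Fin n → Fin n → Set
Cover D u v = D u v ≡ true × (∀ w → D u w ≡ true → D w v ≡ false)

HasseEdge : ∀ {n} → (Fin n → Fin n → Bool) → Fin n → Fin n → Set
HasseEdge D u v = Cover D u v ⊎ Cover D v u

IsTreelikeOrientation : ∀ {n} → Graph n → (Fin n → Fin n → Bool) → Set
IsTreelikeOrientation G D = IsTransitiveOrientation G D × IsTree (HasseEdge D)

IsTreelikeComparability : ∀ {n} → Graph n → Set
IsTreelikeComparability {n} G =
  Σ (Fin n → Fin n → Bool) λ D → IsTreelikeOrientation G D

IsRoot : ∀ {n} → Graph n → Fin n → Set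
IsRoot {n} G r = ∀ (v : Fin n) → ¬ (v ≡ r) → adj G r v ≡ true

IsArborescence : ∀ {n} → Graph n → Set
IsArborescence {n} G =
  Σ (Fin n → Fin n → Bool) λ D → IsTreelikeOrientation G D ×
    Σ (Fin n) λ r → IsRoot G r ×
      ((∀ v → D v r ≡ false) ⊎ (∀ v → D r v ≡ false))

HasInduced : ∀ {m n} → Graph m → Graph n → Set
HasInduced {m} {n} H G =
  Σ (Fin m → Fin n) λ f → Injective _≡_ _≡_ f ×
    (∀ i j → adj G (f i) (f j) ≡ adj H i j)

c4adj : Fin 4 → Fin 4 → Bool
c4adj zero (suc zero) = true
c4adj zero (suc (suc (suc zero))) = true
c4adj (suc zero) zero = true
c4adj (suc zero) (suc (suc zero)) = true
c4adj (suc (suc zero)) (suc zero) = true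
c4adj (suc (suc zero)) (suc (suc (suc zero))) = true
c4adj (suc (suc (suc zero))) (suc (suc zero)) = true
c4adj (suc (suc (suc zero))) zero = true
c4adj _ _ = false

p4adj : Fin 4 → Fin 4 → Bool
p4adj zero (suc zero) = true
p4adj (suc zero) zero = true
p4adj (suc zero) (suc (suc zero)) = true
p4adj (suc (suc zero)) (suc zero) = true
p4adj (suc (suc zero)) (suc (suc (suc zero))) = true
p4adj (suc (suc (suc zero))) (suc (suc zero)) = true
p4adj _ _ = false

private
  pattern f0 = zero
  pattern f1 = suc zero
  pattern f2 = suc (suc zero)
  pattern f3 = suc (suc (suc zero))

  c4sym : ∀ u v → c4adj u v ≡ c4adj v u
  c4sym f0 f0 = refl
  c4sym f0 f1 = refl
  c4sym f0 f2 = refl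
  c4sym f0 f3 = refl
  c4sym f1 f0 = refl
  c4sym f1 f1 = refl
  c4sym f1 f2 = refl
  c4sym f1 f3 = refl
  c4sym f2 f0 = refl
  c4sym f2 f1 = refl
  c4sym f2 f2 = refl
  c4sym f2 f3 = refl
  c4sym f3 f0 = refl
  c4sym f3 f1 = refl
  c4sym f3 f2 = refl
  c4sym f3 f3 = refl

  p4sym : ∀ u v → p4adj u v ≡ p4adj v u
  p4sym f0 f0 = refl
  p4sym f0 f1 = refl
  p4sym f0 f2 = refl
  p4sym f0 f3 = refl
  p4sym f1 f0 = refl
  p4sym f1 f1 = refl
  p4sym f1 f2 = refl
  p4sym f1 f3 = refl
  p4sym f2 f0 = refl
  p4sym f2 f1 = refl
  p4sym f2 f2 = refl
  p4sym f2 f3 = refl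
  p4sym f3 f0 = refl
  p4sym f3 f1 = refl
  p4sym f3 f2 = refl
  p4sym f3 f3 = refl

  c4irr : ∀ v → c4adj v v ≡ false
  c4irr f0 = refl
  c4irr f1 = refl
  c4irr f2 = refl
  c4irr f3 = refl

  p4irr : ∀ v → p4adj v v ≡ false
  p4irr f0 = refl
  p4irr f1 = refl
  p4irr f2 = refl
  p4irr f3 = refl

C4 : Graph 4
C4 = record { adj = c4adj ; adj-sym = c4sym ; adj-irrefl = c4irr }

P4 : Graph 4
P4 = record { adj = p4adj ; adj-sym = p4sym ; adj-irrefl = p4irr }

{-# OPTIONS --safe #-}
-- Orient an arborescence so that its root r is the least element. If a vertex w had two
-- lower covers p ≠ q, then for a maximal common lower bound m (r is one) the saturated
-- chains from m up to p and up to q would close up through w into a cycle of the Hasse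
-- diagram; so lower covers are unique and every down-set is a chain. The middle vertex of
-- an induced path x–y–z then lies below x and z, and a C₄ or P₄ a–b–c–d, which contains the
-- induced paths a–b–c and b–c–d, would force b < c < b.
-- Conversely, a connected graph without induced C₄ and P₄ has a universal vertex w, since
-- a non-universal vertex always has a neighbour with a strictly larger closed neighbourhood.
-- By C₄-freeness the vertices below w or those above w are pairwise adjacent, and then a
-- minimal element below w (resp. a maximal one above w) is a universal source (resp. sink).
module Submission where

open import Defs
open import Level using (0ℓ)
open import Data.Nat using (ℕ)
open import Data.Fin using (Fin; zero; suc; inject₁; fromℕ; fromℕ<)
open import Data.Fin.Properties using (any?; all?; ¬∀⟶∃¬) renaming (_≟_ to _≟ᶠ_)
open import Data.Fin.Induction using (spo-wellFounded)
open import Data.Bool using (Bool; true; false)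
open import Data.Bool.Properties using (¬-not; not-¬) renaming (_≟_ to _≟ᵇ_)
open import Data.Product using (∃₂; ∃-syntax; _×_; _,_; proj₁; proj₂)
open import Data.Sum using (_⊎_; inj₁; inj₂; fromInj₁; swap; map₂)
open import Data.Unit using (⊤; tt)
open import Data.Empty using (⊥; ⊥-elim)
open import Data.List using (List; []; _∷_; _++_; length; lookup)
open import Data.List.Membership.Propositional.Properties using (∈-lookup)
open import Data.List.Relation.Unary.All as All using (All; []; _∷_)
import Data.List.Relation.Unary.All.Properties as All
open import Data.List.Relation.Unary.AllPairs as AllPairs using ([]; _∷_)
import Data.List.Relation.Unary.AllPairs.Properties as AllPairs
open import Data.List.Relation.Unary.Linked as Linked using (Linked; [-]; _∷_)
open import Data.List.Relation.Unary.Linked.Properties using (Linked⇒AllPairs)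
open import Data.List.Relation.Unary.Unique.Propositional using (Unique)
open import Function using (_∘_; flip)
open import Function.Bundles using (_⇔_; mk⇔)
open import Function.Definitions using (Injective)
open import Induction.WellFounded using (WellFounded; Acc; acc)
open import Relation.Binary using (Rel; Transitive; Decidable)
open import Relation.Binary.PropositionalEquality
  using (_≡_; _≢_; refl; sym; trans; cong; subst; ≢-sym; isEquivalence; resp₂; module ≡-Reasoning)
open import Relation.Binary.Construct.Closure.ReflexiveTransitive using (Star; ε; _◅_)
open import Relation.Nullary using (¬_; Dec; yes; no; ¬?)
open import Relation.Nullary.Decidable using (_×-dec_; _⊎-dec_)
import Relation.Unary as U

lastOf : ∀ {A : Set} → A → List A → A
lastOf x []       = x
lastOf _ (y ∷ ys) = lastOf y ys

lastOf-++ : ∀ {A : Set} (x : A) xs ys → lastOf x (xs ++ ys) ≡ lastOf (lastOf x xs) ys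
lastOf-++ x []       ys = refl
lastOf-++ _ (y ∷ xs) ys = lastOf-++ y xs ys

lookup-lastOf : ∀ {A : Set} (x : A) ys → lookup (x ∷ ys) (fromℕ (length ys)) ≡ lastOf x ys
lookup-lastOf x []       = refl
lookup-lastOf _ (y ∷ ys) = lookup-lastOf y ys

lookup-injective : ∀ {A : Set} {xs : List A} → Unique xs → Injective _≡_ _≡_ (lookup xs)
lookup-injective (_    ∷ _) {zero}  {zero}  _ = refl
lookup-injective (x∉xs ∷ _) {zero}  {suc j} e = ⊥-elim (All.lookup x∉xs (∈-lookup j) e)
lookup-injective (x∉xs ∷ _) {suc i} {zero}  e = ⊥-elim (All.lookup x∉xs (∈-lookup i) (sym e))
lookup-injective (_    ∷ u) {suc i} {suc j} e = cong suc (lookup-injective u e)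

module _ {A : Set} {R : Rel A 0ℓ} where

  Linked-++ : ∀ {x} xs {ys} → Linked R (x ∷ xs) → Linked R (lastOf x xs ∷ ys) → Linked R (x ∷ xs ++ ys)
  Linked-++ []       _       l′ = l′
  Linked-++ (_ ∷ xs) (r ∷ l) l′ = r ∷ Linked-++ xs l l′

  Linked-lookup : ∀ {x} ys → Linked R (x ∷ ys) →
                  ∀ i → R (lookup (x ∷ ys) (inject₁ i)) (lookup (x ∷ ys) (suc i))
  Linked-lookup (_ ∷ _)  (r ∷ _) zero    = r
  Linked-lookup (_ ∷ ys) (_ ∷ l) (suc i) = Linked-lookup ys l i

module _ {n : ℕ} where

  -- The hypothesis y ≢ lastOf y zs excludes the closed path x, y, x of length two.
  closed-path⇒cycle : ∀ {R : Fin n → Fin n → Set} x y zs → y ≢ lastOf y zs →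
                      Unique (x ∷ y ∷ zs) → Linked R (x ∷ y ∷ zs) → R (lastOf y zs) x → HasCycle R
  closed-path⇒cycle x y []       y≢y = ⊥-elim (y≢y refl)
  closed-path⇒cycle {R} x y (z ∷ zs) _ unique linked closing =
    length zs , lookup (x ∷ y ∷ z ∷ zs) , lookup-injective unique ,
    Linked-lookup (y ∷ z ∷ zs) linked ,
    subst (λ v → R v x) (sym (lookup-lastOf x (y ∷ z ∷ zs))) closing

  HasCycle-map : ∀ {R S : Fin n → Fin n → Set} → (∀ {u v} → R u v → S u v) → HasCycle R → HasCycle S
  HasCycle-map f (k , g , g-injective , steps , closing) =
    k , g , g-injective , (λ i → f (steps i)) , f closing

  Star-crossing : ∀ {R : Rel (Fin n) 0ℓ} {P : U.Pred (Fin n) 0ℓ} → U.Decidable P → ∀ {a b} →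
                  Star R a b → P a → ¬ P b → ∃₂ λ x y → P x × ¬ P y × R x y
  Star-crossing P? ε pa ¬pb = ⊥-elim (¬pb pa)
  Star-crossing P? {a} (_◅_ {j = c} r walk) pa ¬pb with P? c
  ... | yes pc = Star-crossing P? walk pc ¬pb
  ... | no ¬pc = a , c , pa , ¬pc , r

  irreflexive-transitive⇒wellFounded : ∀ {ℓ} {_<_ : Rel (Fin n) ℓ} →
    (∀ {x} → ¬ x < x) → Transitive _<_ → WellFounded _<_
  irreflexive-transitive⇒wellFounded {_<_ = _<_} irrefl <-trans = spo-wellFounded {_≈_ = _≡_} record
    { isEquivalence = isEquivalence
    ; irrefl        = λ { refl → irrefl }
    ; trans         = <-trans
    ; <-resp-≈      = resp₂ _<_
    }

Cover-flip : ∀ {n} {D : Fin n → Fin n → Bool} {u v} → Cover (flip D) u v → Cover D v u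
Cover-flip (v≺u , nothing-between) =
  v≺u , λ w v≺w → ¬-not (λ w≺u → not-¬ v≺w (nothing-between w w≺u))

flip-transitive : ∀ {n} {D : Fin n → Fin n → Bool} → IsTransitive D → IsTransitive (flip D)
flip-transitive D-trans u v w v≺u w≺v = D-trans w v u w≺v v≺u

HasseEdge-flip : ∀ {n} {D : Fin n → Fin n → Bool} {u v} → HasseEdge (flip D) u v → HasseEdge D u v
HasseEdge-flip {D = D} (inj₁ u⋖v) = inj₂ (Cover-flip {D = D} u⋖v)
HasseEdge-flip {D = D} (inj₂ v⋖u) = inj₁ (Cover-flip {D = D} v⋖u)

module StrictOrder {n : ℕ} (D : Fin n → Fin n → Bool) (D-trans : IsTransitive D)
                   (D-asym : ∀ u v → D u v ≡ true → D v u ≡ false) where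

  infix 4 _≺_ _≼_ _≺?_

  _≺_ : Rel (Fin n) 0ℓ
  u ≺ v = D u v ≡ true

  _≼_ : Rel (Fin n) 0ℓ
  u ≼ v = u ≺ v ⊎ u ≡ v

  _≺?_ : Decidable _≺_
  u ≺? v = D u v ≟ᵇ true

  ≺-trans : Transitive _≺_
  ≺-trans = D-trans _ _ _

  ≺-irrefl : ∀ {u} → ¬ u ≺ u
  ≺-irrefl {u} u≺u = not-¬ u≺u (D-asym u u u≺u)

  ≺⇒≢ : ∀ {u v} → u ≺ v → u ≢ v
  ≺⇒≢ u≺u refl = ≺-irrefl u≺u

  ≼-≺-trans : ∀ {u v w} → u ≼ v → v ≺ w → u ≺ w
  ≼-≺-trans (inj₁ u≺v) v≺w = ≺-trans u≺v v≺w
  ≼-≺-trans (inj₂ refl) v≺w = v≺w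

  ≺-≼-trans : ∀ {u v w} → u ≺ v → v ≼ w → u ≺ w
  ≺-≼-trans u≺v (inj₁ v≺w) = ≺-trans u≺v v≺w
  ≺-≼-trans u≺v (inj₂ refl) = u≺v

  ≺-wellFounded : WellFounded _≺_
  ≺-wellFounded = irreflexive-transitive⇒wellFounded ≺-irrefl ≺-trans

  ≻-wellFounded : WellFounded (flip _≺_)
  ≻-wellFounded = irreflexive-transitive⇒wellFounded ≺-irrefl (flip ≺-trans)

  minimal : ∀ {P : U.Pred (Fin n) 0ℓ} → U.Decidable P → ∀ {x} → P x →
            ∃[ m ] P m × m ≼ x × (∀ z → P z → D z m ≡ false)
  minimal {P} P? {x} px = go (≺-wellFounded x) px
    where
    go : ∀ {x} → Acc _≺_ x → P x → ∃[ m ] P m × m ≼ x × (∀ z → P z → D z m ≡ false)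
    go {x} (acc below) px with any? (λ z → P? z ×-dec z ≺? x)
    ... | yes (z , pz , z≺x) =
      let m , pm , m≼z , m-minimal = go (below z≺x) pz
      in m , pm , inj₁ (≼-≺-trans m≼z z≺x) , m-minimal
    ... | no ∄smaller = x , px , inj₂ refl , λ z pz → ¬-not (λ z≺x → ∄smaller (z , pz , z≺x))

  -- An upper cover of a below b is a minimal element of the interval (a, b].
  cover-above : ∀ {a b} → a ≺ b → ∃[ c ] Cover D a c × c ≼ b
  cover-above {a} {b} a≺b =
    let c , (a≺c , c≼b) , _ , c-minimal =
          minimal (λ c → a ≺? c ×-dec (c ≺? b ⊎-dec c ≟ᶠ b)) (a≺b , inj₂ refl)
    in c , (a≺c , λ w a≺w → ¬-not λ w≺c → not-¬ w≺c (c-minimal w (a≺w , inj₁ (≺-≼-trans w≺c c≼b)))) , c≼b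

  record SaturatedChain (a b : Fin n) : Set where
    field
      vertices : List (Fin n)
      linked   : Linked (Cover D) (a ∷ vertices)
      between  : All (λ t → a ≺ t × t ≼ b) vertices
      ends     : lastOf a vertices ≡ b

    unique : Unique vertices
    unique with Linked⇒AllPairs ≺-trans (Linked.map proj₁ linked)
    ... | _ ∷ increasing = AllPairs.map ≺⇒≢ increasing

  saturatedChain : ∀ {a b} → a ≺ b → SaturatedChain a b
  saturatedChain {a} = go (≻-wellFounded a)
    where
    go : ∀ {a b} → Acc (flip _≺_) a → a ≺ b → SaturatedChain a b
    go (acc above) a≺b with cover-above a≺b
    ... | c , a⋖c , inj₂ refl = record
      { vertices = c ∷ [] ; linked = a⋖c ∷ [-] ; between = (a≺b , inj₂ refl) ∷ [] ; ends = refl }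
    ... | c , a⋖c@(a≺c , _) , inj₁ c≺b =
      let module C = SaturatedChain (go (above a≺c) c≺b) in record
      { vertices = c ∷ C.vertices
      ; linked   = a⋖c ∷ C.linked
      ; between  = (a≺c , inj₁ c≺b) ∷ All.map (λ (c≺t , t≼b) → ≺-trans a≺c c≺t , t≼b) C.between
      ; ends     = C.ends
      }

module Treelike {n : ℕ} (D : Fin n → Fin n → Bool) (D-trans : IsTransitive D)
                (D-asym : ∀ u v → D u v ≡ true → D v u ≡ false)
                (acyclic : ¬ HasCycle (HasseEdge D)) where

  open StrictOrder D D-trans D-asym

  module Dual = StrictOrder (flip D) (flip-transitive D-trans) (λ u v → D-asym v u)

  cover-below : ∀ {a b} → a ≺ b → ∃[ c ] a ≼ c × Cover D c b
  cover-below a≺b =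
    let c , b⋖c , c≽a = Dual.cover-above a≺b
    in c , map₂ sym c≽a , Cover-flip {D = D} b⋖c

  lower-covers-incomparable : ∀ {p q w} → Cover D p w → Cover D q w → ¬ p ≺ q
  lower-covers-incomparable (_ , nothing-between) (q≺w , _) p≺q = not-¬ q≺w (nothing-between _ p≺q)

  -- The descending chain from p to m lies in [m, p) and the ascending chain from m to q
  -- in (m, q]; maximality of m makes them disjoint, so together with w they form a cycle.
  lower-covers-cycle : ∀ {p q w m} → Cover D p w → Cover D q w → p ≢ q → m ≺ p → m ≺ q →
                       (∀ x → x ≺ p × x ≺ q → D m x ≡ false) → HasCycle (HasseEdge D)
  lower-covers-cycle {p} {q} {w} {m} p⋖w@(p≺w , _) q⋖w@(q≺w , _) p≢q m≺p m≺q m-maximal =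
    closed-path⇒cycle w p (↓.vertices ++ ↑.vertices) (p≢q ∘ flip trans last≡q) unique linked closing
    where
    module ↓ = Dual.SaturatedChain (Dual.saturatedChain m≺p)
    module ↑ = SaturatedChain (saturatedChain m≺q)

    last≡q : lastOf p (↓.vertices ++ ↑.vertices) ≡ q
    last≡q = begin
      lastOf p (↓.vertices ++ ↑.vertices)    ≡⟨ lastOf-++ p ↓.vertices ↑.vertices ⟩
      lastOf (lastOf p ↓.vertices) ↑.vertices ≡⟨ cong (λ x → lastOf x ↑.vertices) ↓.ends ⟩
      lastOf m ↑.vertices                    ≡⟨ ↑.ends ⟩
      q                                      ∎
      where open ≡-Reasoning

    linked : Linked (HasseEdge D) (w ∷ p ∷ ↓.vertices ++ ↑.vertices)
    linked = inj₂ p⋖w ∷ Linked-++ ↓.vertices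
      (Linked.map (inj₂ ∘ Cover-flip {D = D}) ↓.linked)
      (subst (λ x → Linked (HasseEdge D) (x ∷ ↑.vertices)) (sym ↓.ends) (Linked.map inj₁ ↑.linked))

    closing : HasseEdge D (lastOf p (↓.vertices ++ ↑.vertices)) w
    closing = subst (λ x → HasseEdge D x w) (sym last≡q) (inj₁ q⋖w)

    p⋠q : ¬ p ≼ q
    p⋠q (inj₁ p≺q) = lower-covers-incomparable p⋖w q⋖w p≺q
    p⋠q (inj₂ p≡q) = p≢q p≡q

    outside-interval : ∀ {t} → m ≺ t → t ≺ p → ¬ t ≼ q
    outside-interval m≺t t≺p (inj₁ t≺q) = not-¬ m≺t (m-maximal _ (t≺p , t≺q))
    outside-interval m≺t t≺p (inj₂ refl) = lower-covers-incomparable q⋖w p⋖w t≺p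

    unique : Unique (w ∷ p ∷ ↓.vertices ++ ↑.vertices)
    unique =
      All.map (≢-sym ∘ ≺⇒≢)
        (p≺w ∷ All.++⁺ (All.map (λ (t≺p , _) → ≺-trans t≺p p≺w) ↓.between)
                       (All.map (λ (_ , t≼q) → ≼-≺-trans t≼q q≺w) ↑.between)) ∷
      All.++⁺ (All.map (λ (t≺p , _) → ≢-sym (≺⇒≢ t≺p)) ↓.between)
              (All.map (λ { (_ , t≼q) refl → p⋠q t≼q }) ↑.between) ∷
      AllPairs.++⁺ ↓.unique ↑.unique
        (All.map (λ (s≺p , _) →
                    All.map (λ { (m≺t , t≼q) refl → outside-interval m≺t s≺p t≼q }) ↑.between)
                 ↓.between)

  lower-covers-equal : ∀ {p q w z} → Cover D p w → Cover D q w → z ≺ p → z ≺ q → p ≡ q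
  lower-covers-equal {p} {q} p⋖w q⋖w z≺p z≺q with p ≟ᶠ q
  ... | yes p≡q = p≡q
  ... | no p≢q =
    let m , (m≺p , m≺q) , _ , m-maximal = Dual.minimal (λ x → x ≺? p ×-dec x ≺? q) (z≺p , z≺q)
    in ⊥-elim (acyclic (lower-covers-cycle p⋖w q⋖w p≢q m≺p m≺q m-maximal))

  module _ {r : Fin n} (r-least : ∀ v → v ≢ r → r ≺ v) where

    lower-cover-unique : ∀ {p q w} → Cover D p w → Cover D q w → p ≡ q
    lower-cover-unique {p} {q} p⋖w q⋖w with p ≟ᶠ r | q ≟ᶠ r
    ... | yes refl | yes refl = refl
    ... | yes refl | no q≢r   = ⊥-elim (lower-covers-incomparable p⋖w q⋖w (r-least q q≢r))
    ... | no p≢r   | yes refl = ⊥-elim (lower-covers-incomparable q⋖w p⋖w (r-least p p≢r))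
    ... | no p≢r   | no q≢r   = lower-covers-equal p⋖w q⋖w (r-least p p≢r) (r-least q q≢r)

    down-set-chain : ∀ {v x y} → x ≺ v → y ≺ v → x ≢ y → x ≺ y ⊎ y ≺ x
    down-set-chain {v} = go (≺-wellFounded v)
      where
      go : ∀ {v x y} → Acc _≺_ v → x ≺ v → y ≺ v → x ≢ y → x ≺ y ⊎ y ≺ x
      go (acc below) x≺v y≺v x≢y with cover-below x≺v | cover-below y≺v
      ... | p , x≼p , p⋖v | q , y≼q , q⋖v with lower-cover-unique p⋖v q⋖v
      ... | refl with x≼p | y≼q
      ...   | inj₂ refl | inj₂ refl = ⊥-elim (x≢y refl)
      ...   | inj₂ refl | inj₁ y≺x  = inj₂ y≺x
      ...   | inj₁ x≺y  | inj₂ refl = inj₁ x≺y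
      ...   | inj₁ x≺p  | inj₁ y≺p  = go (below (proj₁ p⋖v)) x≺p y≺p x≢y

flip-transitiveOrientation : ∀ {n} {G : Graph n} {D} →
  IsTransitiveOrientation G D → IsTransitiveOrientation G (flip D)
flip-transitiveOrientation {G = G} ((orient , D⇒adj , D-asym) , D-trans) =
  ( (λ u v uv → swap (orient u v uv))
  , (λ u v vu → trans (adj-sym G u v) (D⇒adj v u vu))
  , (λ u v → D-asym v u) )
  , flip-transitive D-trans

private
  pattern #0 = zero
  pattern #1 = suc zero
  pattern #2 = suc (suc zero)
  pattern #3 = suc (suc (suc zero))

module _ {n : ℕ} (G : Graph n) where

  Edge-sym : ∀ {u v} → Edge G u v → Edge G v u
  Edge-sym {u} {v} uv = trans (adj-sym G v u) uv

  Edge⇒≢ : ∀ {u v} → Edge G u v → u ≢ v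
  Edge⇒≢ {u} uu refl = not-¬ uu (adj-irrefl G u)

  Independent : Rel (Fin n) 0ℓ
  Independent u v = u ≢ v × adj G u v ≡ false

  Independent-sym : ∀ {u v} → Independent u v → Independent v u
  Independent-sym {u} {v} (u≢v , uv) = ≢-sym u≢v , trans (adj-sym G v u) uv

  InducedP₃ : Fin n → Fin n → Fin n → Set
  InducedP₃ a b c = Edge G a b × Edge G b c × Independent a c

  Clique : U.Pred (Fin n) 0ℓ → Set
  Clique P = ∀ {a b} → P a → P b → a ≢ b → Edge G a b

  clique-or-independent-pair : ∀ {P} → U.Decidable P → Clique P ⊎ ∃₂ λ a b → P a × P b × Independent a b
  clique-or-independent-pair P?
    with any? (λ a → any? (λ b → P? a ×-dec P? b ×-dec ¬? (a ≟ᶠ b) ×-dec adj G a b ≟ᵇ false))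
  ... | yes (a , b , pair) = inj₂ (a , b , pair)
  ... | no ∄pair = inj₁ λ {a} {b} pa pb a≢b → ¬-not (λ a≁b → ∄pair (a , b , pa , pb , a≢b , a≁b))

  induced₄ : (H : Graph 4) (a b c d : Fin n) → Unique (a ∷ b ∷ c ∷ d ∷ []) →
             adj G a b ≡ adj H #0 #1 → adj G a c ≡ adj H #0 #2 → adj G a d ≡ adj H #0 #3 →
             adj G b c ≡ adj H #1 #2 → adj G b d ≡ adj H #1 #3 → adj G c d ≡ adj H #2 #3 →
             HasInduced H G
  induced₄ H a b c d unique ab ac ad bc bd cd =
    lookup (a ∷ b ∷ c ∷ d ∷ []) , lookup-injective unique , table
    where
    diagonal : ∀ u i → adj G u u ≡ adj H i i
    diagonal u i = trans (adj-irrefl G u) (sym (adj-irrefl H i))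

    reversed : ∀ {u v i j} → adj G u v ≡ adj H i j → adj G v u ≡ adj H j i
    reversed {u} {v} {i} {j} uv = trans (adj-sym G v u) (trans uv (adj-sym H i j))

    table : ∀ i j → adj G (lookup (a ∷ b ∷ c ∷ d ∷ []) i) (lookup (a ∷ b ∷ c ∷ d ∷ []) j) ≡ adj H i j
    table #0 #0 = diagonal a #0
    table #0 #1 = ab
    table #0 #2 = ac
    table #0 #3 = ad
    table #1 #0 = reversed ab
    table #1 #1 = diagonal b #1
    table #1 #2 = bc
    table #1 #3 = bd
    table #2 #0 = reversed ac
    table #2 #1 = reversed bc
    table #2 #2 = diagonal c #2
    table #2 #3 = cd
    table #3 #0 = reversed ad
    table #3 #1 = reversed bd
    table #3 #2 = reversed cd
    table #3 #3 = diagonal d #3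

  induced-C4 : ∀ {a b c d} → Edge G a b → Edge G b c → Edge G c d → Edge G d a →
               Independent a c → Independent b d → HasInduced C4 G
  induced-C4 ab bc cd da (a≢c , ac) (b≢d , bd) =
    induced₄ C4 _ _ _ _
      ((Edge⇒≢ ab ∷ a≢c ∷ ≢-sym (Edge⇒≢ da) ∷ []) ∷ (Edge⇒≢ bc ∷ b≢d ∷ []) ∷ (Edge⇒≢ cd ∷ []) ∷ [] ∷ [])
      ab ac (Edge-sym da) bc bd cd

  induced-P4 : ∀ {a b c d} → Edge G a b → Edge G b c → Edge G c d →
               Independent a c → Independent b d → Independent a d → HasInduced P4 G
  induced-P4 ab bc cd (a≢c , ac) (b≢d , bd) (a≢d , ad) =
    induced₄ P4 _ _ _ _
      ((Edge⇒≢ ab ∷ a≢c ∷ a≢d ∷ []) ∷ (Edge⇒≢ bc ∷ b≢d ∷ []) ∷ (Edge⇒≢ cd ∷ []) ∷ [] ∷ [])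
      ab ac ad bc bd cd

  ¬HasInduced-of-overlapping-P₃s : (H : Graph 4) → Edge H #0 #1 → Edge H #1 #2 → Edge H #2 #3 →
    adj H #0 #2 ≡ false → adj H #1 #3 ≡ false →
    (∀ {a b c d} → InducedP₃ a b c → InducedP₃ b c d → ⊥) → ¬ HasInduced H G
  ¬HasInduced-of-overlapping-P₃s H e01 e12 e23 n02 n13 no-overlap (f , f-injective , f-induced) =
    no-overlap (edge e01 , edge e12 , (λ ()) ∘ f-injective , trans (f-induced #0 #2) n02)
               (edge e12 , edge e23 , (λ ()) ∘ f-injective , trans (f-induced #1 #3) n13)
    where
    edge : ∀ {i j} → Edge H i j → Edge G (f i) (f j)
    edge {i} {j} ij = trans (f-induced i j) ij

  module _ {D : Fin n → Fin n → Bool} (to : IsTransitiveOrientation G D) where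

    private
      orient : ∀ u v → Edge G u v → D u v ≡ true ⊎ D v u ≡ true
      orient = proj₁ (proj₁ to)

      D⇒adj : ∀ u v → D u v ≡ true → Edge G u v
      D⇒adj = proj₁ (proj₂ (proj₁ to))

      D-asym : ∀ u v → D u v ≡ true → D v u ≡ false
      D-asym = proj₂ (proj₂ (proj₁ to))

      D-trans : IsTransitive D
      D-trans = proj₂ to

    open StrictOrder D D-trans D-asym

    comparable⇒Edge : ∀ {u v} → u ≺ v ⊎ v ≺ u → Edge G u v
    comparable⇒Edge (inj₁ u≺v) = D⇒adj _ _ u≺v
    comparable⇒Edge (inj₂ v≺u) = Edge-sym (D⇒adj _ _ v≺u)

    P₃-middle-below : (∀ {v x y} → x ≺ v → y ≺ v → x ≢ y → x ≺ y ⊎ y ≺ x) →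
                      ∀ {x y z} → InducedP₃ x y z → y ≺ x × y ≺ z
    P₃-middle-below down-set-chain (xy , yz , x≢z , x≁z) with orient _ _ xy | orient _ _ yz
    ... | inj₂ y≺x | inj₁ y≺z = y≺x , y≺z
    ... | inj₁ x≺y | inj₁ y≺z = ⊥-elim (not-¬ (comparable⇒Edge (inj₁ (≺-trans x≺y y≺z))) x≁z)
    ... | inj₁ x≺y | inj₂ z≺y = ⊥-elim (not-¬ (comparable⇒Edge (down-set-chain x≺y z≺y x≢z)) x≁z)
    ... | inj₂ y≺x | inj₂ z≺y = ⊥-elim (not-¬ (comparable⇒Edge (inj₂ (≺-trans z≺y y≺x))) x≁z)

    root-source⇒least : ∀ {r} → IsRoot G r → (∀ v → D v r ≡ false) → ∀ v → v ≢ r → r ≺ v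
    root-source⇒least {r} r-root r-source v v≢r with orient r v (r-root v v≢r)
    ... | inj₁ r≺v = r≺v
    ... | inj₂ v≺r = ⊥-elim (not-¬ v≺r (r-source v))

    C4-P4-free : ¬ HasCycle (HasseEdge D) → ∀ {r} → (∀ v → v ≢ r → r ≺ v) →
                 ¬ HasInduced C4 G × ¬ HasInduced P4 G
    C4-P4-free acyclic r-least =
      ¬HasInduced-of-overlapping-P₃s C4 refl refl refl refl refl no-overlap ,
      ¬HasInduced-of-overlapping-P₃s P4 refl refl refl refl refl no-overlap
      where
      middle-below : ∀ {x y z} → InducedP₃ x y z → y ≺ x × y ≺ z
      middle-below = P₃-middle-below (Treelike.down-set-chain D D-trans D-asym acyclic r-least)

      no-overlap : ∀ {a b c d} → InducedP₃ a b c → InducedP₃ b c d → ⊥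
      no-overlap abc bcd = not-¬ (proj₂ (middle-below abc)) (D-asym _ _ (proj₁ (middle-below bcd)))

    below-root-is-root : ∀ {w r} → IsRoot G w → Clique (_≺ w) → r ≺ w → IsRoot G r
    below-root-is-root {w} w-root below-clique r≺w v v≢r with v ≟ᶠ w
    ... | yes refl = D⇒adj _ _ r≺w
    ... | no v≢w with orient w v (w-root v v≢w)
    ...   | inj₁ w≺v = D⇒adj _ _ (≺-trans r≺w w≺v)
    ...   | inj₂ v≺w = below-clique r≺w v≺w (≢-sym v≢r)

    source-root : ∀ {w} → IsRoot G w → Clique (_≺ w) → ∃[ r ] IsRoot G r × (∀ v → D v r ≡ false)
    source-root w-root below-clique with minimal {P = λ _ → ⊤} (λ _ → yes tt) tt
    ... | r , _ , inj₂ refl , r-minimal = r , w-root , λ v → r-minimal v tt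
    ... | r , _ , inj₁ r≺w , r-minimal =
      r , below-root-is-root w-root below-clique r≺w , λ v → r-minimal v tt

  source-or-sink-root : ∀ {D w} → IsTransitiveOrientation G D → ¬ HasInduced C4 G → IsRoot G w →
    ∃[ r ] IsRoot G r × ((∀ v → D v r ≡ false) ⊎ (∀ v → D r v ≡ false))
  source-or-sink-root {D} {w} to ¬C4 w-root
    with clique-or-independent-pair (λ x → D x w ≟ᵇ true)
       | clique-or-independent-pair (λ x → D w x ≟ᵇ true)
  ... | inj₁ below-clique | _ =
    let r , r-root , r-source = source-root to w-root below-clique in r , r-root , inj₁ r-source
  ... | inj₂ _ | inj₁ above-clique =
    let r , r-root , r-sink = source-root (flip-transitiveOrientation {G = G} to) w-root above-clique
    in r , r-root , inj₂ r-sink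
  ... | inj₂ (a , b , a≺w , b≺w , a∥b) | inj₂ (c , d , w≺c , w≺d , c∥d) =
    ⊥-elim (¬C4 (induced-C4 (comparable⇒Edge to (inj₁ (D-trans _ _ _ a≺w w≺c)))
                            (comparable⇒Edge to (inj₂ (D-trans _ _ _ b≺w w≺c)))
                            (comparable⇒Edge to (inj₁ (D-trans _ _ _ b≺w w≺d)))
                            (comparable⇒Edge to (inj₂ (D-trans _ _ _ a≺w w≺d)))
                            a∥b c∥d))
    where
    D-trans : IsTransitive D
    D-trans = proj₂ to

  infix 4 _∈N[_] _∈N[_]?

  _∈N[_] : Fin n → Fin n → Set
  u ∈N[ v ] = Edge G v u ⊎ u ≡ v

  _∈N[_]? : ∀ u v → Dec (u ∈N[ v ])
  u ∈N[ v ]? = adj G v u ≟ᵇ true ⊎-dec u ≟ᶠ v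

  _⊐_ : Rel (Fin n) 0ℓ
  x ⊐ v = (∀ {u} → u ∈N[ v ] → u ∈N[ x ]) × ∃[ y ] y ∈N[ x ] × ¬ y ∈N[ v ]

  ⊐-wellFounded : WellFounded _⊐_
  ⊐-wellFounded = irreflexive-transitive⇒wellFounded
    (λ (_ , _ , y∈ , y∉) → y∉ y∈)
    (λ (N[x]⊇N[v] , y , y∈N[x] , y∉N[v]) (N[v]⊇N[u] , z , z∈N[v] , z∉N[u]) →
       N[x]⊇N[v] ∘ N[v]⊇N[u] , z , N[x]⊇N[v] z∈N[v] , z∉N[u])

  -- On a walk from v to a non-neighbour, take the first edge x–y leaving N[v]; any neighbour
  -- z of v not adjacent to x would span an induced C₄ (v x y z) or P₄ (z v x y).
  dominating-neighbour : Connected G → ¬ HasInduced C4 G → ¬ HasInduced P4 G →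
                         ∀ {v u} → ¬ u ∈N[ v ] → ∃[ x ] x ⊐ v
  dominating-neighbour (_ , walk) ¬C4 ¬P4 {v} {u} u∉N[v]
    with Star-crossing (_∈N[ v ]?) (walk v u) (inj₂ refl) u∉N[v]
  ... | x , y , x∈N[v] , y∉N[v] , xy = x , N[v]⊆N[x] , y , inj₁ xy , y∉N[v]
    where
    vx : Edge G v x
    vx = fromInj₁ (λ { refl → ⊥-elim (y∉N[v] (inj₁ xy)) }) x∈N[v]

    v∥y : Independent v y
    v∥y = (λ v≡y → y∉N[v] (inj₂ (sym v≡y))) , ¬-not (y∉N[v] ∘ inj₁)

    N[v]⊆N[x] : ∀ {z} → z ∈N[ v ] → z ∈N[ x ]
    N[v]⊆N[x] (inj₂ refl) = inj₁ (Edge-sym vx)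
    N[v]⊆N[x] {z} (inj₁ vz) with z ≟ᶠ x | adj G x z ≟ᵇ true
    ... | yes z≡x | _      = inj₂ z≡x
    ... | no _    | yes xz = inj₁ xz
    ... | no z≢x  | no x≁z with adj G z y ≟ᵇ true
    ...   | yes zy = ⊥-elim (¬C4 (induced-C4 vx xy (Edge-sym zy) (Edge-sym vz) v∥y x∥z))
      where
      x∥z : Independent x z
      x∥z = ≢-sym z≢x , ¬-not x≁z
    ...   | no z≁y = ⊥-elim (¬P4 (induced-P4 (Edge-sym vz) vx xy z∥x v∥y z∥y))
      where
      z∥x : Independent z x
      z∥x = Independent-sym (≢-sym z≢x , ¬-not x≁z)
      z∥y : Independent z y
      z∥y = (λ { refl → y∉N[v] (inj₁ vz) }) , ¬-not z≁y

  universal-vertex : Connected G → ¬ HasInduced C4 G → ¬ HasInduced P4 G → ∃[ w ] IsRoot G w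
  universal-vertex connected ¬C4 ¬P4 = go (⊐-wellFounded (fromℕ< (proj₁ connected)))
    where
    go : ∀ {v} → Acc _⊐_ v → ∃[ w ] IsRoot G w
    go {v} (acc dominating) with all? (_∈N[ v ]?)
    ... | yes N[v]-all = v , λ u u≢v → fromInj₁ (⊥-elim ∘ u≢v) (N[v]-all u)
    ... | no ¬N[v]-all =
      let u , u∉N[v] = ¬∀⟶∃¬ n _ (_∈N[ v ]?) ¬N[v]-all
          x , x⊐v    = dominating-neighbour connected ¬C4 ¬P4 u∉N[v]
      in go (dominating x⊐v)

  arborescence⇒C4-P4-free : IsArborescence G → ¬ HasInduced C4 G × ¬ HasInduced P4 G
  arborescence⇒C4-P4-free (D , (to , _ , acyclic) , r , r-root , inj₁ r-source) =
    C4-P4-free to acyclic (root-source⇒least to r-root r-source)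
  arborescence⇒C4-P4-free (D , (to , _ , acyclic) , r , r-root , inj₂ r-sink) =
    C4-P4-free to′ (acyclic ∘ HasCycle-map {R = HasseEdge (flip D)} (HasseEdge-flip {D = D}))
      (root-source⇒least to′ r-root r-sink)
    where
    to′ : IsTransitiveOrientation G (flip D)
    to′ = flip-transitiveOrientation {G = G} to

corollary1 : ∀ {n : ℕ} (G : Graph n) → Connected G →
    (IsArborescence G ⇔
      (IsTreelikeComparability G × ¬ HasInduced C4 G × ¬ HasInduced P4 G))
corollary1 G connected = mk⇔
  (λ arborescence@(D , treelike , _) → (D , treelike) , arborescence⇒C4-P4-free G arborescence)
  (λ ((D , treelike@(to , _)) , ¬C4 , ¬P4) →
     let w , w-root = universal-vertex G connected ¬C4 ¬P4
     in D , treelike , source-or-sink-root G to ¬C4 w-root)
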